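{- Let $\{M_d\mid d\ge0\}$ be a nice family, $d\ge0$, and $i_r,\dots,i_1$ nonnegative integers. Setting $i_{r+1}:=d$, $$W_{M_d}(i_r,\ldots,i_1)=\prod_{j=1}^rW_{i_{j+1}}(i_j).$$
   Context: Two matroids are identified ($M\simeq M'$) if they have isomorphic lattices of flats. For a matroid $M$ with lattice of flats $L$, $\operatorname{crk}F=\operatorname{rk}M-\operatorname{rk}F$, and the contraction $M^F$ is the matroid on the complement of $F$ with lattice of flats $\cong\{G\ge F\}$. A nice family is a sequence $\{M_d\}$ with $\operatorname{rk}M_d=d$ such that $M_d^F\simeq M_k$ for every corank-$k$ flat $F$ of $M_d$. $W_k(j)$ denotes the number of flats of $M_k$ of corank $j$. The $r$-Whitney number is $W_M(i_r,\ldots,i_1):=\#\{(F_r,\ldots,F_1)\in L^r: F_r\le\cdots\le F_1,\ \operatorname{crk}F_j=i_j\ \forall j\}$. -}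

module Defs where

open import Data.Bool using (Bool; true; false; _∧_; _∨_; not; T)
open import Data.Nat using (ℕ; zero; suc; _+_; _*_; _∸_; _≤_; _<_; _≡ᵇ_; _<ᵇ_)
open import Data.Fin using (Fin)
open import Data.Fin.Subset using (Subset; _⊆_; _∪_; _∩_; ∣_∣; ⁅_⁆; ⊤)
open import Data.Fin.Subset.Properties using (_⊆?_)
open import Data.List using (List; []; _∷_; length; map; concatMap; allFin)
open import Data.Bool.ListAction using (and)
open import Data.Vec using (Vec; []; _∷_; lookup)
open import Data.Product using (Σ; _×_; _,_)
open import Relation.Nullary.Decidable using (⌊_⌋)
open import Relation.Binary.PropositionalEquality using (_≡_)
open import Function.Bundles using (_⇔_)

record Matroid (n : ℕ) : Set where
  field
    r          : Subset n → ℕ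
    r-bounded  : ∀ X → r X ≤ ∣ X ∣
    r-mono     : ∀ X Y → X ⊆ Y → r X ≤ r Y
    r-submod   : ∀ X Y → r (X ∪ Y) + r (X ∩ Y) ≤ r X + r Y

open Matroid public

rk : ∀ {n} → Matroid n → ℕ
rk M = r M ⊤

crk : ∀ {n} → Matroid n → Subset n → ℕ
crk M F = rk M ∸ r M F

isFlat : ∀ {n} → Matroid n → Subset n → Bool
isFlat {n} M F =
  and (map (λ e → lookup F e ∨ (r M F <ᵇ r M (F ∪ ⁅ e ⁆))) (allFin n))

Flat : ∀ {n} → Matroid n → Subset n → Set
Flat M F = T (isFlat M F)

-- "M^F ≃ M'": the interval {G flat of M | F ⊆ G} of the lattice of flats
-- of M (= lattice of flats of the contraction M^F) is order-isomorphic
-- to the lattice of flats of M'.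

ContractionIso : ∀ {n m} → Matroid n → Subset n → Matroid m → Set
ContractionIso {n} {m} M F M' =
  Σ (Subset n → Subset m) λ f →
  Σ (Subset m → Subset n) λ g →
    (∀ G → Flat M G → F ⊆ G → Flat M' (f G) × g (f G) ≡ G)
  × (∀ H → Flat M' H → (Flat M (g H) × F ⊆ g H) × f (g H) ≡ H)
  × (∀ G G' → Flat M G → F ⊆ G → Flat M G' → F ⊆ G' →
       (G ⊆ G' ⇔ f G ⊆ f G'))

record NiceFamily : Set₁ where
  field
    size     : ℕ → ℕ
    M        : (d : ℕ) → Matroid (size d)
    rank-M   : ∀ d → rk (M d) ≡ d
    contract : ∀ d k (F : Subset (size d)) → Flat (M d) F → crk (M d) F ≡ k →
               ContractionIso (M d) F (M k)

allSubsets : (n : ℕ) → List (Subset n)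
allSubsets zero    = [] ∷ []
allSubsets (suc n) = concatMap (λ s → (true ∷ s) ∷ (false ∷ s) ∷ []) (allSubsets n)

allVecs : ∀ {A : Set} → List A → (k : ℕ) → List (Vec A k)
allVecs xs zero    = [] ∷ []
allVecs xs (suc k) = concatMap (λ x → map (x ∷_) (allVecs xs k)) xs

count : ∀ {A : Set} → (A → Bool) → List A → ℕ
count p []       = 0
count p (x ∷ xs) with p x
... | true  = suc (count p xs)
... | false = count p xs

-- Tuples (F_r, …, F_1) stored as a vector in this order, indices
-- (i_r, …, i_1) likewise.  Condition: each F_j is a flat with crk F_j = i_j,
-- and F_r ⊆ F_{r-1} ⊆ … ⊆ F_1.
chainOK : ∀ {n k} → Matroid n → Vec (Subset n) k → Vec ℕ k → Bool
chainOK M []            []            = true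
chainOK M (F ∷ [])      (i ∷ [])      = isFlat M F ∧ (crk M F ≡ᵇ i)
chainOK M (F ∷ G ∷ Fs)  (i ∷ j ∷ is)  =
  isFlat M F ∧ (crk M F ≡ᵇ i) ∧ ⌊ F ⊆? G ⌋ ∧ chainOK M (G ∷ Fs) (j ∷ is)

WhitneyR : ∀ {n r} → Matroid n → Vec ℕ r → ℕ
WhitneyR {n} {r} M is = count (λ Fs → chainOK M Fs is) (allVecs (allSubsets n) r)

W : NiceFamily → ℕ → ℕ → ℕ
W 𝓜 k j = count (λ F → isFlat (NiceFamily.M 𝓜 k) F ∧ (crk (NiceFamily.M 𝓜 k) F ≡ᵇ j))
                (allSubsets (NiceFamily.size 𝓜 k))

-- ∏_{j=1}^r W_{i_{j+1}}(i_j) with i_{r+1} := d, for the list (i_r, …, i_1):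
-- prodW d (i_r ∷ … ∷ i_1) = W_d(i_r) * W_{i_r}(i_{r-1}) * … * W_{i_2}(i_1)
prodW : ∀ {r} → NiceFamily → ℕ → Vec ℕ r → ℕ
prodW 𝓜 a []       = 1
prodW 𝓜 a (b ∷ bs) = W 𝓜 a b * prodW 𝓜 b bs

-- Sort the chains F_r ⊆ … ⊆ F_1 counted by W_{M_d}(i_r, …, i_1) by their smallest
-- member F = F_r. The rest of the chain lies in the interval above F, which the nice-family
-- axiom identifies with the lattice of flats of M_{i_r}. The identification preserves
-- coranks, because the corank of a flat is the length of the longest chain of flats above
-- it, an invariant of the order. So each of the W_d(i_r) choices of F contributes
-- W_{M_{i_r}}(i_{r-1}, …, i_1), and induction on r gives the product.

module Submission where

open import Defs
open import Data.Bool using (Bool; true; false; _∧_; _∨_; T)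
open import Data.Bool.Properties using (T-∧; ∧-assoc; ∧-identityʳ) renaming (_≟_ to _≟ᵇ_)
open import Data.Bool.ListAction using (and)
open import Data.Empty using (⊥-elim)
open import Data.Fin using (Fin)
open import Data.Fin.Properties using (¬∀⟶∃¬)
open import Data.Fin.Subset using (Subset; _⊆_; _∪_; _∩_; ⁅_⁆; ⊤; _∈_; _∉_; ∣_∣)
open import Data.Fin.Subset.Properties
  using (_∈?_; _⊆?_; ⊆-refl; ⊆-trans; ⊆⊤; ∈⊤; p⊆p∪q; q⊆p∪q; x∈p∪q⁻; x∈p∩q⁺; x∈⁅x⁆; x∈⁅y⁆⇒x≡y; ∣⁅x⁆∣≡1)
open import Data.List using (List; []; _∷_; _++_; map; concatMap; allFin)
open import Data.List.Membership.Propositional using () renaming (_∈_ to _∈ˡ_)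
open import Data.List.Membership.Propositional.Properties using (∈-allFin)
open import Data.List.Relation.Unary.Any using (here; there)
open import Data.Nat using (ℕ; zero; suc; _+_; _*_; _≤_; _<_; _<ᵇ_; _≡ᵇ_)
open import Data.Nat.Properties
open import Data.Product using (∃; _×_; _,_; proj₁; proj₂)
open import Data.Sum using (inj₁; inj₂)
open import Data.Vec using (Vec; []; _∷_; lookup)
open import Data.Vec.Properties using (≡-dec; []=⇒lookup; lookup⇒[]=)
open import Function using (_∘_; id)
open import Algebra.Properties.CommutativeSemigroup +-commutativeSemigroup
  using () renaming (interchange to +-interchange)
open import Function.Bundles using (_⇔_; mk⇔; Equivalence)
open import Relation.Binary.Definitions using (DecidableEquality)
open import Relation.Binary.PropositionalEquality
  using (_≡_; refl; sym; trans; cong; cong₂; subst; module ≡-Reasoning)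
open import Relation.Nullary using (¬_; yes; no; does; contradiction; _→-dec_)
open import Relation.Nullary.Decidable using (⌊_⌋; toWitness; fromWitness; decidable-stable)

open Equivalence using (to; from)

private
  variable
    A B : Set
    n m k : ℕ

∑ : List A → (A → ℕ) → ℕ
∑ []       h = 0
∑ (x ∷ xs) h = h x + ∑ xs h

infix 5 ∑
syntax ∑ L (λ x → e) = ∑[ x ← L ] e

𝟙 : Bool → ℕ
𝟙 true  = 1
𝟙 false = 0

∑-cong : (L : List A) {h h′ : A → ℕ} → (∀ x → h x ≡ h′ x) → ∑ L h ≡ ∑ L h′
∑-cong []       eq = refl
∑-cong (x ∷ xs) eq = cong₂ _+_ (eq x) (∑-cong xs eq)

∑-++ : (L L′ : List A) (h : A → ℕ) → ∑ (L ++ L′) h ≡ ∑ L h + ∑ L′ h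
∑-++ []       L′ h = refl
∑-++ (x ∷ xs) L′ h = trans (cong (h x +_) (∑-++ xs L′ h)) (sym (+-assoc (h x) _ _))

∑-map : (L : List A) (f : A → B) (h : B → ℕ) → ∑ (map f L) h ≡ ∑[ x ← L ] h (f x)
∑-map []       f h = refl
∑-map (x ∷ xs) f h = cong (h (f x) +_) (∑-map xs f h)

∑-concatMap : (L : List A) (f : A → List B) (h : B → ℕ) →
  ∑ (concatMap f L) h ≡ ∑[ x ← L ] ∑ (f x) h
∑-concatMap []       f h = refl
∑-concatMap (x ∷ xs) f h =
  trans (∑-++ (f x) (concatMap f xs) h) (cong (∑ (f x) h +_) (∑-concatMap xs f h))

∑-zero : (L : List A) → ∑[ x ← L ] 0 ≡ 0
∑-zero []       = refl
∑-zero (x ∷ xs) = ∑-zero xs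

∑-+ : (L : List A) (h h′ : A → ℕ) → ∑[ x ← L ] (h x + h′ x) ≡ ∑ L h + ∑ L h′
∑-+ []       h h′ = refl
∑-+ (x ∷ xs) h h′ =
  trans (cong (h x + h′ x +_) (∑-+ xs h h′)) (+-interchange (h x) (h′ x) _ _)

∑-*ˡ : (L : List A) (c : ℕ) (h : A → ℕ) → ∑[ x ← L ] c * h x ≡ c * ∑ L h
∑-*ˡ []       c h = sym (*-zeroʳ c)
∑-*ˡ (x ∷ xs) c h = trans (cong (c * h x +_) (∑-*ˡ xs c h)) (sym (*-distribˡ-+ c (h x) _))

∑-*ʳ : (L : List A) (c : ℕ) (h : A → ℕ) → ∑[ x ← L ] h x * c ≡ ∑ L h * c
∑-*ʳ L c h = trans (∑-cong L (λ x → *-comm (h x) c)) (trans (∑-*ˡ L c h) (*-comm c _))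

∑-comm : (L₁ : List A) (L₂ : List B) (h : A → B → ℕ) →
  ∑[ a ← L₁ ] ∑[ b ← L₂ ] h a b ≡ ∑[ b ← L₂ ] ∑[ a ← L₁ ] h a b
∑-comm []       L₂ h = sym (∑-zero L₂)
∑-comm (x ∷ xs) L₂ h = trans (cong (∑ L₂ (h x) +_) (∑-comm xs L₂ h)) (sym (∑-+ L₂ (h x) _))

count≡∑𝟙 : (p : A → Bool) (L : List A) → count p L ≡ ∑[ x ← L ] 𝟙 (p x)
count≡∑𝟙 p []       = refl
count≡∑𝟙 p (x ∷ xs) with p x
... | true  = cong suc (count≡∑𝟙 p xs)
... | false = count≡∑𝟙 p xs

count-cong : {p q : A → Bool} → (∀ x → p x ≡ q x) → (L : List A) → count p L ≡ count q L
count-cong {p = p} {q} eq L =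
  trans (count≡∑𝟙 p L) (trans (∑-cong L (cong 𝟙 ∘ eq)) (sym (count≡∑𝟙 q L)))

𝟙-∧ : ∀ p q → 𝟙 (p ∧ q) ≡ 𝟙 p * 𝟙 q
𝟙-∧ true  q = sym (+-identityʳ (𝟙 q))
𝟙-∧ false q = refl

𝟙-∧-* : ∀ p q x → 𝟙 p * (𝟙 q * x) ≡ 𝟙 (p ∧ q) * x
𝟙-∧-* p q x = trans (sym (*-assoc (𝟙 p) (𝟙 q) x)) (cong (_* x) (sym (𝟙-∧ p q)))

𝟙-*-cong : ∀ {p q x y} → (T p → T q) → (T q → T p) → (T p → x ≡ y) → 𝟙 p * x ≡ 𝟙 q * y
𝟙-*-cong {true}  {true}  _   _   x≡y = cong (_+ 0) (x≡y _)
𝟙-*-cong {true}  {false} p⇒q _   _   = ⊥-elim (p⇒q _)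
𝟙-*-cong {false} {true}  _   q⇒p _   = ⊥-elim (q⇒p _)
𝟙-*-cong {false} {false} _   _   _   = refl

count-∧ˡ : ∀ b (q : A → Bool) (L : List A) → count (λ x → b ∧ q x) L ≡ 𝟙 b * count q L
count-∧ˡ b q L = begin
  count (λ x → b ∧ q x) L     ≡⟨ count≡∑𝟙 _ L ⟩
  ∑[ x ← L ] 𝟙 (b ∧ q x)      ≡⟨ ∑-cong L (λ x → 𝟙-∧ b (q x)) ⟩
  ∑[ x ← L ] 𝟙 b * 𝟙 (q x)    ≡⟨ ∑-*ˡ L (𝟙 b) (𝟙 ∘ q) ⟩
  𝟙 b * ∑ L (𝟙 ∘ q)          ≡⟨ cong (𝟙 b *_) (sym (count≡∑𝟙 q L)) ⟩
  𝟙 b * count q L             ∎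
  where open ≡-Reasoning

∑-𝟙-*-const : (p : A → Bool) (h : A → ℕ) (c : ℕ) → (∀ {x} → T (p x) → h x ≡ c) →
  (L : List A) → ∑[ x ← L ] 𝟙 (p x) * h x ≡ count p L * c
∑-𝟙-*-const p h c h≡c L = begin
  ∑[ x ← L ] 𝟙 (p x) * h x    ≡⟨ ∑-cong L (λ x → 𝟙-*-cong id id h≡c) ⟩
  ∑[ x ← L ] 𝟙 (p x) * c      ≡⟨ ∑-*ʳ L c (𝟙 ∘ p) ⟩
  ∑ L (𝟙 ∘ p) * c             ≡⟨ cong (_* c) (sym (count≡∑𝟙 p L)) ⟩
  count p L * c               ∎
  where open ≡-Reasoning

-- Stated with `does` rather than ⌊_⌋ so that `does ((x ∷ s) ≟ˢ (y ∷ c))` computes to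
-- `does (x ≟ᵇ y) ∧ does (s ≟ˢ c)`.
EnumeratesOnce : DecidableEquality A → List A → Set
EnumeratesOnce _≟_ L = ∀ c → count (λ a → does (a ≟ c)) L ≡ 1

∑-select : (_≟_ : DecidableEquality A) (L : List A) → EnumeratesOnce _≟_ L →
  ∀ c b w → ∑[ a ← L ] 𝟙 (does (a ≟ c) ∧ b) * w ≡ 𝟙 b * w
∑-select _≟_ L once c b w = begin
  ∑[ a ← L ] 𝟙 (does (a ≟ c) ∧ b) * w       ≡⟨ ∑-cong L (λ a → sym (𝟙-∧-* (does (a ≟ c)) b w)) ⟩
  ∑[ a ← L ] 𝟙 (does (a ≟ c)) * (𝟙 b * w)   ≡⟨ ∑-*ʳ L (𝟙 b * w) (λ a → 𝟙 (does (a ≟ c))) ⟩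
  ∑ L (λ a → 𝟙 (does (a ≟ c))) * (𝟙 b * w)  ≡⟨ cong (_* (𝟙 b * w)) (sym (count≡∑𝟙 _ L)) ⟩
  count (λ a → does (a ≟ c)) L * (𝟙 b * w)  ≡⟨ cong (_* (𝟙 b * w)) (once c) ⟩
  1 * (𝟙 b * w)                             ≡⟨ *-identityˡ (𝟙 b * w) ⟩
  𝟙 b * w                                   ∎
  where open ≡-Reasoning

record Matching (P : A → Bool) (Q : B → Bool) : Set where
  field
    forward          : A → B
    backward         : B → A
    forward-Q        : ∀ {a} → T (P a) → T (Q (forward a))
    backward-P       : ∀ {b} → T (Q b) → T (P (backward b))
    backward-forward : ∀ {a} → T (P a) → backward (forward a) ≡ a
    forward-backward : ∀ {b} → T (Q b) → forward (backward b) ≡ b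

module _ {_≟ᴬ_ : DecidableEquality A} {_≟ᴮ_ : DecidableEquality B} {P : A → Bool} {Q : B → Bool}
         (m : Matching P Q) (h₁ : A → ℕ) (h₂ : B → ℕ)
         (h-matched : ∀ {a} → T (P a) → h₁ a ≡ h₂ (Matching.forward m a)) where
  open Matching m

  private
    paired : ∀ a b →
      𝟙 (does (b ≟ᴮ forward a) ∧ P a) * h₁ a ≡ 𝟙 (does (a ≟ᴬ backward b) ∧ Q b) * h₂ b
    paired a b with b ≟ᴮ forward a | a ≟ᴬ backward b
    ... | yes refl | yes a≡ba =
      𝟙-*-cong forward-Q (λ q → subst (T ∘ P) (sym a≡ba) (backward-P q)) h-matched
    ... | yes refl | no  a≢ba = 𝟙-*-cong (λ p → a≢ba (sym (backward-forward p))) (λ ()) h-matched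
    ... | no  b≢fb | yes refl =
      𝟙-*-cong {x = h₁ (backward b)} (λ ()) (λ q → b≢fb (sym (forward-backward q))) (λ ())
    ... | no  _    | no  _    = refl

  -- Double counting: insert the indicator of b = forward a, swap the sums, and remove the
  -- indicator of a = backward b.
  ∑-reindex : (L₁ : List A) (L₂ : List B) →
    EnumeratesOnce _≟ᴬ_ L₁ → EnumeratesOnce _≟ᴮ_ L₂ →
    ∑[ a ← L₁ ] 𝟙 (P a) * h₁ a ≡ ∑[ b ← L₂ ] 𝟙 (Q b) * h₂ b
  ∑-reindex L₁ L₂ once₁ once₂ = begin
    ∑[ a ← L₁ ] 𝟙 (P a) * h₁ a
      ≡⟨ ∑-cong L₁ (λ a → sym (∑-select _≟ᴮ_ L₂ once₂ (forward a) (P a) (h₁ a))) ⟩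
    ∑[ a ← L₁ ] ∑[ b ← L₂ ] 𝟙 (does (b ≟ᴮ forward a) ∧ P a) * h₁ a
      ≡⟨ ∑-cong L₁ (λ a → ∑-cong L₂ (paired a)) ⟩
    ∑[ a ← L₁ ] ∑[ b ← L₂ ] 𝟙 (does (a ≟ᴬ backward b) ∧ Q b) * h₂ b
      ≡⟨ ∑-comm L₁ L₂ _ ⟩
    ∑[ b ← L₂ ] ∑[ a ← L₁ ] 𝟙 (does (a ≟ᴬ backward b) ∧ Q b) * h₂ b
      ≡⟨ ∑-cong L₂ (λ b → ∑-select _≟ᴬ_ L₁ once₁ (backward b) (Q b) (h₂ b)) ⟩
    ∑[ b ← L₂ ] 𝟙 (Q b) * h₂ b
      ∎
    where open ≡-Reasoning

_≟ˢ_ : DecidableEquality (Subset n)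
_≟ˢ_ = ≡-dec _≟ᵇ_

allSubsets-enumeratesOnce : ∀ n → EnumeratesOnce _≟ˢ_ (allSubsets n)
allSubsets-enumeratesOnce zero    [] = refl
allSubsets-enumeratesOnce (suc n) (y ∷ c) = begin
  count (λ a → does (a ≟ˢ (y ∷ c))) (allSubsets (suc n))
    ≡⟨ count≡∑𝟙 _ (allSubsets (suc n)) ⟩
  ∑ (allSubsets (suc n)) (λ a → 𝟙 (does (a ≟ˢ (y ∷ c))))
    ≡⟨ ∑-concatMap (allSubsets n) _ _ ⟩
  ∑[ s ← allSubsets n ] (𝟙 (does (true ≟ᵇ y) ∧ does (s ≟ˢ c)) + (𝟙 (does (false ≟ᵇ y) ∧ does (s ≟ˢ c)) + 0))
    ≡⟨ ∑-cong (allSubsets n) (λ s → unique-head y (does (s ≟ˢ c))) ⟩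
  ∑[ s ← allSubsets n ] 𝟙 (does (s ≟ˢ c))
    ≡⟨ sym (count≡∑𝟙 _ (allSubsets n)) ⟩
  count (λ s → does (s ≟ˢ c)) (allSubsets n)
    ≡⟨ allSubsets-enumeratesOnce n c ⟩
  1 ∎
  where
  open ≡-Reasoning
  unique-head : ∀ y e → 𝟙 (does (true ≟ᵇ y) ∧ e) + (𝟙 (does (false ≟ᵇ y) ∧ e) + 0) ≡ 𝟙 e
  unique-head true  e = +-identityʳ (𝟙 e)
  unique-head false e = +-identityʳ (𝟙 e)

count-allVecs-suc : (S : List A) (p : Vec A (suc k) → Bool) →
  count p (allVecs S (suc k)) ≡ ∑[ x ← S ] count (λ v → p (x ∷ v)) (allVecs S k)
count-allVecs-suc {k = k} S p = begin
  count p (allVecs S (suc k))                          ≡⟨ count≡∑𝟙 p (allVecs S (suc k)) ⟩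
  ∑ (allVecs S (suc k)) (𝟙 ∘ p)                       ≡⟨ ∑-concatMap S _ (𝟙 ∘ p) ⟩
  ∑[ x ← S ] ∑ (map (x ∷_) (allVecs S k)) (𝟙 ∘ p)     ≡⟨ ∑-cong S (λ x → ∑-map (allVecs S k) (x ∷_) (𝟙 ∘ p)) ⟩
  ∑[ x ← S ] ∑[ v ← allVecs S k ] 𝟙 (p (x ∷ v))       ≡⟨ ∑-cong S (λ x → sym (count≡∑𝟙 _ (allVecs S k))) ⟩
  ∑[ x ← S ] count (λ v → p (x ∷ v)) (allVecs S k)    ∎
  where open ≡-Reasoning

T-and-map⁻ : (h : A → Bool) (xs : List A) → T (and (map h xs)) → ∀ {x} → x ∈ˡ xs → T (h x)
T-and-map⁻ h (y ∷ ys) t (here refl) = proj₁ (to T-∧ t)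
T-and-map⁻ h (y ∷ ys) t (there x∈ys) = T-and-map⁻ h ys (proj₂ (to T-∧ t)) x∈ys

T-and-map⁺ : (h : A → Bool) (xs : List A) → (∀ x → T (h x)) → T (and (map h xs))
T-and-map⁺ h []       _   = _
T-and-map⁺ h (y ∷ ys) all = from T-∧ (all y , T-and-map⁺ h ys all)

∪-least : {p q s : Subset n} → p ⊆ s → q ⊆ s → p ∪ q ⊆ s
∪-least {p = p} {q} p⊆s q⊆s x∈p∪q with x∈p∪q⁻ p q x∈p∪q
... | inj₁ x∈p = p⊆s x∈p
... | inj₂ x∈q = q⊆s x∈q

⁅⁆⊆ : {x : Fin n} {p : Subset n} → x ∈ p → ⁅ x ⁆ ⊆ p
⁅⁆⊆ {x = x} x∈p y∈⁅x⁆ = subst (_∈ _) (sym (x∈⁅y⁆⇒x≡y x y∈⁅x⁆)) x∈p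

⊈⇒∃∉ : {p q : Subset n} → ¬ p ⊆ q → ∃ λ x → x ∈ p × x ∉ q
⊈⇒∃∉ {n} {p} {q} p⊈q with ¬∀⟶∃¬ n _ (λ x → x ∈? p →-dec x ∈? q) (λ p⊆q → p⊈q (p⊆q _))
... | x , x∈p⇏x∈q with x ∈? p
...   | yes x∈p = x , x∈p , λ x∈q → x∈p⇏x∈q (λ _ → x∈q)
...   | no  x∉p = ⊥-elim (x∈p⇏x∈q (⊥-elim ∘ x∉p))

module _ (M : Matroid n) where

  Flat⇒r-<-∪ : ∀ {F e} → Flat M F → e ∉ F → r M F < r M (F ∪ ⁅ e ⁆)
  Flat⇒r-<-∪ {F} {e} flat e∉F with lookup F e in eq | T-and-map⁻ _ (allFin n) flat (∈-allFin e)
  ... | true  | _ = ⊥-elim (e∉F (lookup⇒[]= e F eq))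
  ... | false | t = <ᵇ⇒< _ _ t

  r-<-∪⇒Flat : ∀ {F} → (∀ e → e ∉ F → r M F < r M (F ∪ ⁅ e ⁆)) → Flat M F
  r-<-∪⇒Flat {F} increases = T-and-map⁺ _ (allFin n) increases-at
    where
    increases-at : ∀ e → T (lookup F e ∨ (r M F <ᵇ r M (F ∪ ⁅ e ⁆)))
    increases-at e with lookup F e in eq
    ... | true  = _
    ... | false = <⇒<ᵇ (increases e (λ e∈F → contradiction (trans (sym ([]=⇒lookup e∈F)) eq) λ ()))

  Flat-⊤ : Flat M ⊤
  Flat-⊤ = r-<-∪⇒Flat (λ e e∉⊤ → ⊥-elim (e∉⊤ ∈⊤))

  r≤rk : ∀ X → r M X ≤ rk M
  r≤rk X = r-mono M X ⊤ ⊆⊤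

  Flat⇒r-< : ∀ {G G′} → Flat M G → G ⊆ G′ → ¬ G′ ⊆ G → r M G < r M G′
  Flat⇒r-< {G} {G′} flat G⊆G′ G′⊈G with ⊈⇒∃∉ G′⊈G
  ... | e , e∈G′ , e∉G =
    <-≤-trans (Flat⇒r-<-∪ flat e∉G) (r-mono M _ _ (∪-least G⊆G′ (⁅⁆⊆ e∈G′)))

  r-∪-⁅⁆≤ : ∀ X e → r M (X ∪ ⁅ e ⁆) ≤ r M X + 1
  r-∪-⁅⁆≤ X e = begin
    r M (X ∪ ⁅ e ⁆)                         ≤⟨ m≤m+n _ _ ⟩
    r M (X ∪ ⁅ e ⁆) + r M (X ∩ ⁅ e ⁆)       ≤⟨ r-submod M X ⁅ e ⁆ ⟩
    r M X + r M ⁅ e ⁆                       ≤⟨ +-monoʳ-≤ (r M X) (r-bounded M ⁅ e ⁆) ⟩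
    r M X + ∣ ⁅ e ⁆ ∣                       ≡⟨ cong (r M X +_) (∣⁅x⁆∣≡1 e) ⟩
    r M X + 1                               ∎
    where open ≤-Reasoning

  -- span X (allFin n) is the closure of X; adjoining one element at a time lets
  -- submodularity bound its rank inductively.
  span : Subset n → List (Fin n) → Subset n
  span X []       = X
  span X (x ∷ xs) with r M (X ∪ ⁅ x ⁆) ≤? r M X
  ... | yes _ = span X xs ∪ ⁅ x ⁆
  ... | no  _ = span X xs

  ⊆-span : ∀ X xs → X ⊆ span X xs
  ⊆-span X []       = ⊆-refl
  ⊆-span X (x ∷ xs) with r M (X ∪ ⁅ x ⁆) ≤? r M X
  ... | yes _ = ⊆-trans (⊆-span X xs) (p⊆p∪q ⁅ x ⁆)
  ... | no  _ = ⊆-span X xs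

  ∈-span : ∀ X {xs x} → x ∈ˡ xs → r M (X ∪ ⁅ x ⁆) ≤ r M X → x ∈ span X xs
  ∈-span X {x ∷ xs} (here refl) spanned with r M (X ∪ ⁅ x ⁆) ≤? r M X
  ... | yes _         = q⊆p∪q (span X xs) ⁅ x ⁆ (x∈⁅x⁆ x)
  ... | no  unspanned = ⊥-elim (unspanned spanned)
  ∈-span X {y ∷ xs} (there x∈xs) spanned with r M (X ∪ ⁅ y ⁆) ≤? r M X
  ... | yes _ = p⊆p∪q ⁅ y ⁆ (∈-span X x∈xs spanned)
  ... | no  _ = ∈-span X x∈xs spanned

  r-span≤ : ∀ X xs → r M (span X xs) ≤ r M X
  r-span≤ X []       = ≤-refl
  r-span≤ X (x ∷ xs) with r M (X ∪ ⁅ x ⁆) ≤? r M X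
  ... | no  _       = r-span≤ X xs
  ... | yes spanned = +-cancelʳ-≤ (r M X) _ _ (begin
    r M (U ∪ ⁅ x ⁆) + r M X
      ≤⟨ +-mono-≤ (r-mono M _ _ (∪-least (p⊆p∪q _) (⊆-trans (q⊆p∪q X _) (q⊆p∪q U _))))
                  (r-mono M _ _ (λ y∈X → x∈p∩q⁺ (⊆-span X xs y∈X , p⊆p∪q _ y∈X))) ⟩
    r M (U ∪ (X ∪ ⁅ x ⁆)) + r M (U ∩ (X ∪ ⁅ x ⁆))
      ≤⟨ r-submod M U (X ∪ ⁅ x ⁆) ⟩
    r M U + r M (X ∪ ⁅ x ⁆)
      ≤⟨ +-mono-≤ (r-span≤ X xs) spanned ⟩
    r M X + r M X ∎)
    where
    open ≤-Reasoning
    U = span X xs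

  cl : Subset n → Subset n
  cl X = span X (allFin n)

  ⊆-cl : ∀ X → X ⊆ cl X
  ⊆-cl X = ⊆-span X (allFin n)

  r-cl≤ : ∀ X → r M (cl X) ≤ r M X
  r-cl≤ X = r-span≤ X (allFin n)

  Flat-cl : ∀ X → Flat M (cl X)
  Flat-cl X = r-<-∪⇒Flat λ e e∉clX → begin-strict
    r M (cl X)           ≤⟨ r-cl≤ X ⟩
    r M X                <⟨ ≰⇒> (e∉clX ∘ ∈-span X (∈-allFin e)) ⟩
    r M (X ∪ ⁅ e ⁆)      ≤⟨ r-mono M _ _ (∪-least (⊆-trans (⊆-cl X) (p⊆p∪q _)) (q⊆p∪q _ _)) ⟩
    r M (cl X ∪ ⁅ e ⁆)   ∎
    where open ≤-Reasoning

  -- This is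
  -- expressed in the lattice of flats alone, so it transfers along ContractionIso, and it
  -- determines the corank.
  HeightAtMost : Subset n → ℕ → Set
  HeightAtMost G zero    = ∀ G′ → Flat M G′ → G ⊆ G′ → G′ ⊆ G
  HeightAtMost G (suc c) = ∀ G′ → Flat M G′ → G ⊆ G′ → ¬ G′ ⊆ G → HeightAtMost G′ c

  heightAtMost⇒rk≤ : ∀ {G} c → HeightAtMost G c → rk M ≤ r M G + c
  heightAtMost⇒rk≤ {G} zero h = begin
    rk M        ≤⟨ r-mono M ⊤ G (h ⊤ Flat-⊤ ⊆⊤) ⟩
    r M G       ≡⟨ +-identityʳ (r M G) ⟨
    r M G + 0   ∎
    where open ≤-Reasoning
  heightAtMost⇒rk≤ {G} (suc c) h with ⊤ ⊆? G
  ... | yes ⊤⊆G = ≤-trans (r-mono M ⊤ G ⊤⊆G) (m≤m+n _ _)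
  ... | no  ⊤⊈G with ⊈⇒∃∉ ⊤⊈G
  ...   | e , _ , e∉G = begin
    rk M             ≤⟨ heightAtMost⇒rk≤ c (h G′ (Flat-cl _) G⊆G′ G′⊈G) ⟩
    r M G′ + c       ≤⟨ +-monoˡ-≤ c (≤-trans (r-cl≤ _) (r-∪-⁅⁆≤ G e)) ⟩
    r M G + 1 + c    ≡⟨ +-assoc (r M G) 1 c ⟩
    r M G + suc c    ∎
    where
    open ≤-Reasoning
    G′ = cl (G ∪ ⁅ e ⁆)
    G⊆G′ : G ⊆ G′
    G⊆G′ = ⊆-trans (p⊆p∪q _) (⊆-cl _)
    G′⊈G : ¬ G′ ⊆ G
    G′⊈G G′⊆G = e∉G (G′⊆G (⊆-cl _ (q⊆p∪q G _ (x∈⁅x⁆ e))))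

  rk≤⇒heightAtMost : ∀ {G} c → Flat M G → rk M ≤ r M G + c → HeightAtMost G c
  rk≤⇒heightAtMost {G} zero flat rk≤ G′ _ G⊆G′ = decidable-stable (G′ ⊆? G) λ G′⊈G →
    <⇒≱ (Flat⇒r-< flat G⊆G′ G′⊈G) (≤-trans (r≤rk G′) (≤-trans rk≤ (≤-reflexive (+-identityʳ _))))
  rk≤⇒heightAtMost {G} (suc c) flat rk≤ G′ flat′ G⊆G′ G′⊈G = rk≤⇒heightAtMost c flat′ (begin
    rk M              ≤⟨ rk≤ ⟩
    r M G + suc c     ≡⟨ +-suc (r M G) c ⟩
    suc (r M G) + c   ≤⟨ +-monoˡ-≤ c (Flat⇒r-< flat G⊆G′ G′⊈G) ⟩
    r M G′ + c        ∎)
    where open ≤-Reasoning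

  HeightAtMost-crk : ∀ {G} → Flat M G → HeightAtMost G (crk M G)
  HeightAtMost-crk {G} flat = rk≤⇒heightAtMost _ flat (m≤n+m∸n (rk M) (r M G))

  heightAtMost⇒crk≤ : ∀ {G} c → HeightAtMost G c → crk M G ≤ c
  heightAtMost⇒crk≤ {G} c h = m≤n+o⇒m∸n≤o (rk M) (r M G) (heightAtMost⇒rk≤ c h)

isFlatOfCorank : Matroid n → ℕ → Subset n → Bool
isFlatOfCorank M j G = isFlat M G ∧ (crk M G ≡ᵇ j)

isFlatOfCorankAbove : Matroid n → ℕ → Subset n → Subset n → Bool
isFlatOfCorankAbove M j G G′ = ⌊ G ⊆? G′ ⌋ ∧ isFlatOfCorank M j G′

T-isFlatOfCorank : ∀ (M : Matroid n) j G → T (isFlatOfCorank M j G) ⇔ (Flat M G × crk M G ≡ j)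
T-isFlatOfCorank M j G = mk⇔
  (λ t → let flat , crk≡ = to (T-∧ {isFlat M G}) t in flat , ≡ᵇ⇒≡ _ _ crk≡)
  (λ (flat , crk≡) → from T-∧ (flat , ≡⇒≡ᵇ _ _ crk≡))

T-isFlatOfCorankAbove : ∀ (M : Matroid n) j G G′ →
  T (isFlatOfCorankAbove M j G G′) ⇔ (G ⊆ G′ × Flat M G′ × crk M G′ ≡ j)
T-isFlatOfCorankAbove M j G G′ = mk⇔ decode encode
  where
  decode : T (isFlatOfCorankAbove M j G G′) → G ⊆ G′ × Flat M G′ × crk M G′ ≡ j
  decode t = let G⊆G′ , t′ = to (T-∧ {⌊ G ⊆? G′ ⌋}) t
             in toWitness G⊆G′ , to (T-isFlatOfCorank M j G′) t′
  encode : G ⊆ G′ × Flat M G′ × crk M G′ ≡ j → T (isFlatOfCorankAbove M j G G′)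
  encode (G⊆G′ , rest) = from (T-∧ {⌊ G ⊆? G′ ⌋})
    (fromWitness {a? = G ⊆? G′} (λ {x} → G⊆G′ {x}) , from (T-isFlatOfCorank M j G′) rest)

ChainAbove : Matroid n → Subset n → Vec (Subset n) k → Vec ℕ k → Bool
ChainAbove M G []        []       = true
ChainAbove M G (G′ ∷ Gs) (j ∷ js) = ⌊ G ⊆? G′ ⌋ ∧ chainOK M (G′ ∷ Gs) (j ∷ js)

chainsAbove : Matroid n → Subset n → Vec ℕ k → ℕ
chainsAbove {n} {k} M G js = count (λ Gs → ChainAbove M G Gs js) (allVecs (allSubsets n) k)

chainOK-∷ : (M : Matroid n) (G : Subset n) (Gs : Vec (Subset n) k) (j : ℕ) (js : Vec ℕ k) →
  chainOK M (G ∷ Gs) (j ∷ js) ≡ isFlatOfCorank M j G ∧ ChainAbove M G Gs js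
chainOK-∷ M G []      j []      = sym (∧-identityʳ _)
chainOK-∷ M G (_ ∷ _) j (_ ∷ _) = sym (∧-assoc (isFlat M G) _ _)

ChainAbove-∷ : (M : Matroid n) (G G′ : Subset n) (Gs : Vec (Subset n) k) (j : ℕ) (js : Vec ℕ k) →
  ChainAbove M G (G′ ∷ Gs) (j ∷ js) ≡ isFlatOfCorankAbove M j G G′ ∧ ChainAbove M G′ Gs js
ChainAbove-∷ M G G′ Gs j js =
  trans (cong (⌊ G ⊆? G′ ⌋ ∧_) (chainOK-∷ M G′ Gs j js)) (sym (∧-assoc ⌊ G ⊆? G′ ⌋ _ _))

count-allVecs-∷ : (S : List A) (p : Vec A (suc k) → Bool) (b : A → Bool) (q : A → Vec A k → Bool) →
  (∀ x v → p (x ∷ v) ≡ b x ∧ q x v) →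
  count p (allVecs S (suc k)) ≡ ∑[ x ← S ] 𝟙 (b x) * count (q x) (allVecs S k)
count-allVecs-∷ {k = k} S p b q p≡b∧q = begin
  count p (allVecs S (suc k))
    ≡⟨ count-allVecs-suc S p ⟩
  ∑[ x ← S ] count (λ v → p (x ∷ v)) (allVecs S k)
    ≡⟨ ∑-cong S (λ x → count-cong (p≡b∧q x) (allVecs S k)) ⟩
  ∑[ x ← S ] count (λ v → b x ∧ q x v) (allVecs S k)
    ≡⟨ ∑-cong S (λ x → count-∧ˡ (b x) (q x) (allVecs S k)) ⟩
  ∑[ x ← S ] 𝟙 (b x) * count (q x) (allVecs S k)
    ∎
  where open ≡-Reasoning

WhitneyR-∷ : (M : Matroid n) (j : ℕ) (js : Vec ℕ k) →
  WhitneyR M (j ∷ js) ≡ ∑[ G ← allSubsets n ] 𝟙 (isFlatOfCorank M j G) * chainsAbove M G js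
WhitneyR-∷ {n} M j js =
  count-allVecs-∷ (allSubsets n) _ _ (λ G Gs → ChainAbove M G Gs js) (λ G Gs → chainOK-∷ M G Gs j js)

chainsAbove-∷ : (M : Matroid n) (G : Subset n) (j : ℕ) (js : Vec ℕ k) →
  chainsAbove M G (j ∷ js) ≡ ∑[ G′ ← allSubsets n ] 𝟙 (isFlatOfCorankAbove M j G G′) * chainsAbove M G′ js
chainsAbove-∷ {n} M G j js =
  count-allVecs-∷ (allSubsets n) _ _ (λ G′ Gs → ChainAbove M G′ Gs js) (λ G′ Gs → ChainAbove-∷ M G G′ Gs j js)

chainsAbove-least : (M : Matroid n) {B : Subset n} → (∀ {H} → Flat M H → B ⊆ H) →
  (js : Vec ℕ k) → chainsAbove M B js ≡ WhitneyR M js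
chainsAbove-least M         least []       = refl
chainsAbove-least {n} M {B} least (j ∷ js) = begin
  chainsAbove M B (j ∷ js)
    ≡⟨ chainsAbove-∷ M B j js ⟩
  ∑[ H ← allSubsets n ] 𝟙 (isFlatOfCorankAbove M j B H) * chainsAbove M H js
    ≡⟨ ∑-cong (allSubsets n) (λ H → 𝟙-*-cong (proj₂ ∘ to (T-∧ {⌊ B ⊆? H ⌋})) (above H) (λ _ → refl)) ⟩
  ∑[ H ← allSubsets n ] 𝟙 (isFlatOfCorank M j H) * chainsAbove M H js
    ≡⟨ WhitneyR-∷ M j js ⟨
  WhitneyR M (j ∷ js)
    ∎
  where
  open ≡-Reasoning
  above : ∀ H → T (isFlatOfCorank M j H) → T (isFlatOfCorankAbove M j B H)
  above H t = from T-∧ (fromWitness {a? = B ⊆? H} (λ {x} → least (proj₁ (to (T-isFlatOfCorank M j H) t))) , t)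

module Contraction {M : Matroid n} {F : Subset n} {M′ : Matroid m} (iso : ContractionIso M F M′) where

  φ : Subset n → Subset m
  φ = proj₁ iso

  ψ : Subset m → Subset n
  ψ = proj₁ (proj₂ iso)

  module _ {G} (flat : Flat M G) (F⊆G : F ⊆ G) where
    φ-Flat : Flat M′ (φ G)
    φ-Flat = proj₁ (proj₁ (proj₂ (proj₂ iso)) G flat F⊆G)

    ψφ : ψ (φ G) ≡ G
    ψφ = proj₂ (proj₁ (proj₂ (proj₂ iso)) G flat F⊆G)

    φ-⊆⇔ : ∀ {G′} → Flat M G′ → F ⊆ G′ → G ⊆ G′ ⇔ φ G ⊆ φ G′
    φ-⊆⇔ flat′ F⊆G′ = proj₂ (proj₂ (proj₂ (proj₂ iso))) _ _ flat F⊆G flat′ F⊆G′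

  module _ {H} (flat : Flat M′ H) where
    ψ-Flat : Flat M (ψ H)
    ψ-Flat = proj₁ (proj₁ (proj₁ (proj₂ (proj₂ (proj₂ iso))) H flat))

    F⊆ψ : F ⊆ ψ H
    F⊆ψ = proj₂ (proj₁ (proj₁ (proj₂ (proj₂ (proj₂ iso))) H flat))

    φψ : φ (ψ H) ≡ H
    φψ = proj₂ (proj₁ (proj₂ (proj₂ (proj₂ iso))) H flat)

  module _ {G H} (flatG : Flat M G) (F⊆G : F ⊆ G) (flatH : Flat M′ H) where
    ⊆ψ⇔ : G ⊆ ψ H ⇔ φ G ⊆ H
    ⊆ψ⇔ = subst (λ X → G ⊆ ψ H ⇔ φ G ⊆ X) (φψ flatH) (φ-⊆⇔ flatG F⊆G (ψ-Flat flatH) (F⊆ψ flatH))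

    ψ⊆⇔ : ψ H ⊆ G ⇔ H ⊆ φ G
    ψ⊆⇔ = subst (λ X → ψ H ⊆ G ⇔ X ⊆ φ G) (φψ flatH) (φ-⊆⇔ (ψ-Flat flatH) (F⊆ψ flatH) flatG F⊆G)

  φF-least : Flat M F → ∀ {H} → Flat M′ H → φ F ⊆ H
  φF-least flatF flatH = to (⊆ψ⇔ flatF ⊆-refl flatH) (F⊆ψ flatH)

  heightAtMost-φ⁺ : ∀ c {G} → Flat M G → F ⊆ G → HeightAtMost M G c → HeightAtMost M′ (φ G) c
  heightAtMost-φ⁺ zero flat F⊆G h H flatH φG⊆H =
    to (ψ⊆⇔ flat F⊆G flatH) (h (ψ H) (ψ-Flat flatH) (from (⊆ψ⇔ flat F⊆G flatH) φG⊆H))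
  heightAtMost-φ⁺ (suc c) flat F⊆G h H flatH φG⊆H H⊈φG =
    subst (λ X → HeightAtMost M′ X c) (φψ flatH)
      (heightAtMost-φ⁺ c (ψ-Flat flatH) (F⊆ψ flatH)
        (h (ψ H) (ψ-Flat flatH) (from (⊆ψ⇔ flat F⊆G flatH) φG⊆H) (H⊈φG ∘ to (ψ⊆⇔ flat F⊆G flatH))))

  heightAtMost-φ⁻ : ∀ c {G} → Flat M G → F ⊆ G → HeightAtMost M′ (φ G) c → HeightAtMost M G c
  heightAtMost-φ⁻ zero flat F⊆G h G′ flat′ G⊆G′ =
    from (φ-⊆⇔ flat′ F⊆G′ flat F⊆G) (h (φ G′) (φ-Flat flat′ F⊆G′) (to (φ-⊆⇔ flat F⊆G flat′ F⊆G′) G⊆G′))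
    where F⊆G′ = ⊆-trans F⊆G G⊆G′
  heightAtMost-φ⁻ (suc c) flat F⊆G h G′ flat′ G⊆G′ G′⊈G =
    heightAtMost-φ⁻ c flat′ F⊆G′
      (h (φ G′) (φ-Flat flat′ F⊆G′) (to (φ-⊆⇔ flat F⊆G flat′ F⊆G′) G⊆G′)
         (G′⊈G ∘ from (φ-⊆⇔ flat′ F⊆G′ flat F⊆G)))
    where F⊆G′ = ⊆-trans F⊆G G⊆G′

  crk-φ : ∀ {G} → Flat M G → F ⊆ G → crk M′ (φ G) ≡ crk M G
  crk-φ flat F⊆G = ≤-antisym
    (heightAtMost⇒crk≤ M′ _ (heightAtMost-φ⁺ _ flat F⊆G (HeightAtMost-crk M flat)))
    (heightAtMost⇒crk≤ M _ (heightAtMost-φ⁻ _ flat F⊆G (HeightAtMost-crk M′ (φ-Flat flat F⊆G))))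

  matching : ∀ {G} → Flat M G → F ⊆ G → ∀ j →
    Matching (isFlatOfCorankAbove M j G) (isFlatOfCorankAbove M′ j (φ G))
  matching {G} flat F⊆G j = record
    { forward          = φ
    ; backward         = ψ
    ; forward-Q        = forward-Q
    ; backward-P       = backward-P
    ; backward-forward = λ {G′} t → let _ , flat′ , _ = decode G′ t in ψφ flat′ (F⊆ t)
    ; forward-backward = λ {H} t → let _ , flatH , _ = decode′ H t in φψ flatH
    }
    where
    decode  = λ G′ → to (T-isFlatOfCorankAbove M j G G′)
    decode′ = λ H → to (T-isFlatOfCorankAbove M′ j (φ G) H)

    F⊆ : ∀ {G′} → T (isFlatOfCorankAbove M j G G′) → F ⊆ G′
    F⊆ {G′} t = ⊆-trans F⊆G (proj₁ (decode G′ t))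

    forward-Q : ∀ {G′} → T (isFlatOfCorankAbove M j G G′) → T (isFlatOfCorankAbove M′ j (φ G) (φ G′))
    forward-Q {G′} t with decode G′ t
    ... | G⊆G′ , flat′ , crk≡j = from (T-isFlatOfCorankAbove M′ j (φ G) (φ G′))
      ( to (φ-⊆⇔ flat F⊆G flat′ (F⊆ t)) G⊆G′
      , φ-Flat flat′ (F⊆ t)
      , trans (crk-φ flat′ (F⊆ t)) crk≡j )

    backward-P : ∀ {H} → T (isFlatOfCorankAbove M′ j (φ G) H) → T (isFlatOfCorankAbove M j G (ψ H))
    backward-P {H} t with decode′ H t
    ... | φG⊆H , flatH , crk≡j = from (T-isFlatOfCorankAbove M j G (ψ H))
      ( from (⊆ψ⇔ flat F⊆G flatH) φG⊆H
      , ψ-Flat flatH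
      , trans (sym (crk-φ (ψ-Flat flatH) (F⊆ψ flatH))) (trans (cong (crk M′) (φψ flatH)) crk≡j) )

  chainsAbove-φ : ∀ (js : Vec ℕ k) {G} → Flat M G → F ⊆ G → chainsAbove M G js ≡ chainsAbove M′ (φ G) js
  chainsAbove-φ []       flat F⊆G = refl
  chainsAbove-φ (j ∷ js) {G} flat F⊆G = begin
    chainsAbove M G (j ∷ js)
      ≡⟨ chainsAbove-∷ M G j js ⟩
    ∑[ G′ ← allSubsets n ] 𝟙 (isFlatOfCorankAbove M j G G′) * chainsAbove M G′ js
      ≡⟨ ∑-reindex {_≟ᴬ_ = _≟ˢ_} {_≟ᴮ_ = _≟ˢ_} (matching flat F⊆G j) _ _ ih
           (allSubsets n) (allSubsets m) (allSubsets-enumeratesOnce n) (allSubsets-enumeratesOnce m) ⟩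
    ∑[ H ← allSubsets m ] 𝟙 (isFlatOfCorankAbove M′ j (φ G) H) * chainsAbove M′ H js
      ≡⟨ chainsAbove-∷ M′ (φ G) j js ⟨
    chainsAbove M′ (φ G) (j ∷ js)
      ∎
    where
    open ≡-Reasoning
    ih : ∀ {G′} → T (isFlatOfCorankAbove M j G G′) → chainsAbove M G′ js ≡ chainsAbove M′ (φ G′) js
    ih {G′} t with to (T-isFlatOfCorankAbove M j G G′) t
    ... | G⊆G′ , flat′ , _ = chainsAbove-φ js flat′ (⊆-trans F⊆G G⊆G′)

  chainsAbove-F : Flat M F → ∀ (js : Vec ℕ k) → chainsAbove M F js ≡ WhitneyR M′ js
  chainsAbove-F flatF js = trans (chainsAbove-φ js flatF ⊆-refl) (chainsAbove-least M′ (φF-least flatF) js)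

corollary4p4 : (𝓜 : NiceFamily) (d r : ℕ) (is : Vec ℕ r) →
    WhitneyR (NiceFamily.M 𝓜 d) is ≡ prodW 𝓜 d is
corollary4p4 𝓜 d zero    []       = refl
corollary4p4 𝓜 d (suc r) (i ∷ is) = begin
  WhitneyR (M d) (i ∷ is)
    ≡⟨ WhitneyR-∷ (M d) i is ⟩
  ∑[ G ← allSubsets (size d) ] 𝟙 (isFlatOfCorank (M d) i G) * chainsAbove (M d) G is
    ≡⟨ ∑-𝟙-*-const _ _ _ contraction-Whitney (allSubsets (size d)) ⟩
  W 𝓜 d i * WhitneyR (M i) is
    ≡⟨ cong (W 𝓜 d i *_) (corollary4p4 𝓜 i r is) ⟩
  W 𝓜 d i * prodW 𝓜 i is
    ∎
  where
  open ≡-Reasoning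
  open NiceFamily 𝓜
  contraction-Whitney : ∀ {G} → T (isFlatOfCorank (M d) i G) → chainsAbove (M d) G is ≡ WhitneyR (M i) is
  contraction-Whitney {G} t with to (T-isFlatOfCorank (M d) i G) t
  ... | flat , crk≡i = Contraction.chainsAbove-F (contract d i G flat crk≡i) flat is
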